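{- Let $T$, $G$ be graphs and $\Gamma$ a group acting on $G$; let $p\colon G\to G/\Gamma$ be the projection. Assume $T$ is finite, connected, has at least one edge, and that a spanning tree $S$ of $T$ has been chosen. Each edge of $T$ not in $S$ determines a cycle in $T$ consisting of that edge and a simple path in $S$; let $L$ be the set of the lengths of these cycles (a loop giving a cycle of length $1$). Assume that for all $v\in V(G)$, $\gamma\in\Gamma$ and $l\in L\cup\{4\}$ such that there is a (not necessarily simple) path of length $l$ in $G$ from $v$ to $\gamma v$, we have $\gamma=e$. Then the induced action of $\Gamma$ on $\mathrm{Hom}(T,G)$ is strongly regular and free, the poset map $p_T\colon\mathrm{Hom}(T,G)\to\mathrm{Hom}(T,G/\Gamma)$ is rank preserving, and the induced map $\bar p_T\colon\mathrm{Hom}(T,G)/\Gamma\to\mathrm{Hom}(T,G/\Gamma)$ is an isomorphism of posets.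
   Context: Graphs are finite, undirected, loops allowed. $G/\Gamma$ is the quotient graph whose vertices are the $\Gamma$-orbits, two orbits adjacent iff some representatives are adjacent. $\mathrm{Hom}(T,G)$ is the poset of maps $\alpha\colon V(T)\to2^{V(G)}\setminus\{\emptyset\}$ such that whenever $t\sim t'$ every element of $\alpha(t)$ is adjacent to every element of $\alpha(t')$, ordered by pointwise inclusion; it is ranked by $\mathrm{rank}(\alpha)=\sum_{v\in V(T)}(|\alpha(v)|-1)$. $\Gamma$ acts on $\mathrm{Hom}(T,G)$ by $(\gamma\alpha)(t)=\gamma\alpha(t)$, and $p_T(\alpha)(t)=p(\alpha(t))$. For a poset $Q$ with $\Gamma$-action, $Q/\Gamma$ is the poset of orbits with $[x]\le[y]$ iff $x\le\gamma y$ for some $\gamma\in\Gamma$. A free action of $\Gamma$ on a poset $Q$ is strongly regular if whenever $u,v,w\in Q$, $\gamma\in\Gamma$ with $u,v\le w$ and $\gamma u=v$, then $\gamma=e$. -}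

module Defs where

open import Level using (Level; _⊔_)
open import Data.Nat using (ℕ; zero; suc; _∸_; _≤_)
open import Data.Bool using (Bool; true)
open import Data.Fin using (Fin; _≟_)
open import Data.Fin.Subset using (Subset; _∈_; _⊆_; Nonempty; ∣_∣)
open import Data.Fin.Subset.Properties using (_∈?_)
open import Data.Fin.Properties using (any?)
open import Data.Vec using (tabulate; sum)
open import Data.List using (List; []; _∷_)
open import Data.List.Relation.Unary.Unique.Propositional using (Unique)
open import Data.Product using (Σ; ∃; ∃-syntax; Σ-syntax; _×_; _,_; proj₁)
open import Data.Sum using (_⊎_)
open import Relation.Nullary using (¬_)
open import Relation.Nullary.Decidable using (⌊_⌋; _×-dec_)
open import Relation.Binary.PropositionalEquality using (_≡_)
open import Algebra.Bundles using (Group)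

record Graph (n : ℕ) : Set where
  field
    adj     : Fin n → Fin n → Bool
    adj-sym : ∀ x y → adj x y ≡ adj y x

Adj : ∀ {n} → Graph n → Fin n → Fin n → Set
Adj G x y = Graph.adj G x y ≡ true

data Walk {n} (G : Graph n) : ℕ → Fin n → Fin n → Set where
  []  : ∀ {v} → Walk G 0 v v
  _∷_ : ∀ {l u v w} → Adj G u v → Walk G l v w → Walk G (suc l) u w

vertices : ∀ {n} {G : Graph n} {l u w} → Walk G l u w → List (Fin n)
vertices {u = u} []      = u ∷ []
vertices {u = u} (e ∷ p) = u ∷ vertices p

SimplePath : ∀ {n} → Graph n → ℕ → Fin n → Fin n → Set
SimplePath G l u w = Σ (Walk G l u w) λ p → Unique (vertices p)

Connected : ∀ {n} → Graph n → Set
Connected G = ∀ u v → ∃[ l ] Walk G l u v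

HasEdge : ∀ {n} → Graph n → Set
HasEdge G = ∃[ x ] ∃[ y ] Adj G x y

-- a cycle is a loop, or an edge {w,u} together with a simple path
-- from u to w of length ≥ 2 (i.e. a cycle of length ≥ 3)
Acyclic : ∀ {n} → Graph n → Set
Acyclic G = (∀ v → ¬ Adj G v v)
          × (∀ l u w → 2 ≤ l → SimplePath G l u w → ¬ Adj G w u)

IsTree : ∀ {n} → Graph n → Set
IsTree G = Connected G × Acyclic G

IsSpanningTree : ∀ {n} → Graph n → Graph n → Set
IsSpanningTree T S = (∀ u v → Adj S u v → Adj T u v) × IsTree S

-- L: lengths of the fundamental cycles of the non-tree edges {t,t'}
-- (edge plus the simple path from t to t' in S; a loop gives length 1)
CycleLength : ∀ {n} → Graph n → Graph n → ℕ → Set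
CycleLength T S l =
  ∃[ t ] ∃[ t' ] (Adj T t t' × ¬ Adj S t t'
                  × ∃[ k ] (l ≡ suc k × SimplePath S k t t'))

record Action {c ℓ : Level} (Γ : Group c ℓ) {n : ℕ} (G : Graph n)
       : Set (c ⊔ ℓ) where
  open Group Γ
  field
    act      : Carrier → Fin n → Fin n
    act-cong : ∀ {g h} → g ≈ h → ∀ x → act g x ≡ act h x
    act-ε    : ∀ x → act ε x ≡ x
    act-∙    : ∀ g h x → act (g ∙ h) x ≡ act g (act h x)
    act-adj  : ∀ g {x y} → Adj G x y → Adj G (act g x) (act g y)

image : ∀ {n m} → (Fin n → Fin m) → Subset n → Subset m
image f s = tabulate λ y → ⌊ any? (λ x → (x ∈? s) ×-dec (f x ≟ y)) ⌋

-- Q with projection p : G → Q is the quotient graph G/Γ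
-- (Q is determined up to isomorphism by these properties)
record IsQuotientGraph {c ℓ} {Γ : Group c ℓ} {n m} {G : Graph n}
       (A : Action Γ G) (Q : Graph m) (p : Fin n → Fin m) : Set (c ⊔ ℓ) where
  open Action A
  field
    p-surj  : ∀ o → ∃[ x ] p x ≡ o
    p-orbit : ∀ x y → p x ≡ p y → ∃[ γ ] act γ x ≡ y
    p-inv   : ∀ γ x → p (act γ x) ≡ p x
    adj-to  : ∀ o o' → Adj Q o o' → ∃[ x ] ∃[ y ] (p x ≡ o × p y ≡ o' × Adj G x y)
    adj-fro : ∀ x y → Adj G x y → Adj Q (p x) (p y)

RawHom : ℕ → ℕ → Set
RawHom k n = Fin k → Subset n

IsHom : ∀ {k n} → Graph k → Graph n → RawHom k n → Set
IsHom T G α = (∀ t → Nonempty (α t))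
            × (∀ t t' → Adj T t t' → ∀ x y → x ∈ α t → y ∈ α t' → Adj G x y)

Hom : ∀ {k n} → Graph k → Graph n → Set
Hom {k} {n} T G = Σ (RawHom k n) (IsHom T G)

_≤ₕ_ : ∀ {k n} → RawHom k n → RawHom k n → Set
α ≤ₕ β = ∀ t → α t ⊆ β t

_≐_ : ∀ {k n} → RawHom k n → RawHom k n → Set
α ≐ β = ∀ t → α t ≡ β t

rank : ∀ {k n} → RawHom k n → ℕ
rank α = sum (tabulate λ t → ∣ α t ∣ ∸ 1)

_·ₕ_ : ∀ {k n} → (Fin n → Fin n) → RawHom k n → RawHom k n
(f ·ₕ α) t = image f (α t)

mapHom : ∀ {k n m} → (Fin n → Fin m) → RawHom k n → RawHom k m
mapHom p α t = image p (α t)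

module _ {c ℓ} {Γ : Group c ℓ} {k n} {T : Graph k} {G : Graph n}
         (A : Action Γ G) where
  open Group Γ
  open Action A

  FreeOnHom : Set (c ⊔ ℓ)
  FreeOnHom = ∀ γ (α : Hom T G) → (act γ ·ₕ proj₁ α) ≐ proj₁ α → γ ≈ ε

  StronglyRegularOnHom : Set (c ⊔ ℓ)
  StronglyRegularOnHom = ∀ γ (u v w : Hom T G)
    → proj₁ u ≤ₕ proj₁ w → proj₁ v ≤ₕ proj₁ w
    → (act γ ·ₕ proj₁ u) ≐ proj₁ v → γ ≈ ε

  -- orbit relations defining the quotient poset Hom(T,G)/Γ
  SameOrbit : Hom T G → Hom T G → Set c
  SameOrbit α β = ∃[ γ ] (act γ ·ₕ proj₁ α) ≐ proj₁ β

  OrbitLe : Hom T G → Hom T G → Set c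
  OrbitLe α β = ∃[ γ ] proj₁ α ≤ₕ (act γ ·ₕ proj₁ β)

  module _ {m} (Q : Graph m) (p : Fin n → Fin m) where

    RankPreservingPosetMap : Set
    RankPreservingPosetMap =
        (∀ (α : Hom T G) → IsHom T Q (mapHom p (proj₁ α)))
      × (∀ (α β : Hom T G) → proj₁ α ≤ₕ proj₁ β
            → mapHom p (proj₁ α) ≤ₕ mapHom p (proj₁ β))
      × (∀ (α : Hom T G) → rank (mapHom p (proj₁ α)) ≡ rank (proj₁ α))

    record InducedPosetIso : Set (c ⊔ ℓ) where
      field
        well-defined : ∀ α β → SameOrbit α β
                       → mapHom p (proj₁ α) ≐ mapHom p (proj₁ β)
        injective    : ∀ α β → mapHom p (proj₁ α) ≐ mapHom p (proj₁ β)
                       → SameOrbit α β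
        surjective   : ∀ (β : Hom T Q) → Σ[ α ∈ Hom T G ] mapHom p (proj₁ α) ≐ proj₁ β
        monotone     : ∀ α β → OrbitLe α β
                       → mapHom p (proj₁ α) ≤ₕ mapHom p (proj₁ β)
        reflecting   : ∀ α β → mapHom p (proj₁ α) ≤ₕ mapHom p (proj₁ β)
                       → OrbitLe α β

-- The hypothesis for walks of length 4 makes p injective on common
-- neighbourhoods: if x and γ x are both adjacent to y, then x y (γ x) y (γ x)
-- is such a walk, so γ = e.  This gives strong regularity directly and, as
-- every vertex of T has a neighbour, injectivity of p on each α(t), hence rank
-- preservation.  Likewise a point of α(t) matched with a point of γ β(t)
-- forces α(t') ⊆ γ β(t') at every neighbour t' of t; propagating this along T
-- shows that p̄_T is injective and reflects the order.  For surjectivity,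
-- chosen points of β ∈ Hom(T, G/Γ) are lifted backwards along the spanning
-- tree S (independently of the route, because S is acyclic), and every edge
-- of T outside S lifts to an edge, since otherwise the lift of its fundamental
-- cycle would join a vertex to another point of its orbit by a walk of length
-- in L.  The lift of β then sends t to the points over β(t) adjacent to the
-- lifted point at a fixed neighbour of t.

module Submission where

open import Defs
open import Function using (_∘_)
open import Data.Nat using (ℕ; zero; suc; _+_; _∸_; z≤n; s≤s)
open import Data.Bool using (true)
import Data.Bool as Bool
open import Data.Fin using (Fin; zero; suc; _≟_)
open import Data.Fin.Properties using (any?; suc-injective)
open import Data.Fin.Subset
  using (Subset; _∈_; _∉_; _⊆_; ∣_∣; _∪_; ⁅_⁆; ⊥; inside; outside; Nonempty)
open import Data.Fin.Subset.Properties
  using (_∈?_; ⊆-antisym; x∈p∪q⁻; x∈p∪q⁺; x∈⁅x⁆; x∈⁅y⁆⇒x≡y; ∪-identityʳ;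
         ∣⊥∣≡0; ∉⊥)
open import Data.Vec using ([]; _∷_; tabulate; lookup; sum; here; there)
open import Data.Vec.Properties using ([]=⇒lookup; lookup⇒[]=; lookup∘tabulate; tabulate-cong)
open import Data.List.Relation.Unary.Any using (here; there)
open import Data.List.Relation.Unary.All using ([]; _∷_)
import Data.List.Relation.Unary.All as All
open import Data.List.Relation.Unary.All.Properties.Core using (¬Any⇒All¬)
open import Data.List.Relation.Unary.AllPairs using ([]; _∷_)
open import Data.List.Relation.Unary.Unique.Propositional using (Unique)
open import Data.List.Membership.Propositional using () renaming (_∈_ to _∈ₗ_)
import Data.List.Membership.DecPropositional as DecMembership
open import Data.Product using (Σ; ∃; ∃-syntax; _×_; _,_; proj₁; proj₂)
open import Data.Sum using (_⊎_; inj₁; inj₂)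
open import Data.Empty using (⊥-elim)
open import Relation.Nullary using (¬_; Dec; yes; no)
open import Relation.Nullary.Decidable using (⌊_⌋; _×-dec_)
open import Relation.Unary using (Pred; Decidable)
open import Relation.Binary.PropositionalEquality
  using (_≡_; refl; sym; trans; cong; subst; module ≡-Reasoning)
open import Algebra.Bundles using (Group)

filter? : ∀ {n p} {P : Pred (Fin n) p} → Decidable P → Subset n
filter? P? = tabulate (λ x → ⌊ P? x ⌋)

module _ {n p} {P : Pred (Fin n) p} (P? : Decidable P) where

  lookup-filter? : ∀ x → lookup (filter? P?) x ≡ ⌊ P? x ⌋
  lookup-filter? = lookup∘tabulate (λ x → ⌊ P? x ⌋)

  ∈-filter⁺ : ∀ {x} → P x → x ∈ filter? P?
  ∈-filter⁺ {x} Px with P? x in eq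
  ... | yes _  = lookup⇒[]= x (filter? P?) (trans (lookup-filter? x) (cong ⌊_⌋ eq))
  ... | no ¬Px = ⊥-elim (¬Px Px)

  ∈-filter⁻ : ∀ {x} → x ∈ filter? P? → P x
  ∈-filter⁻ {x} x∈ with P? x | trans (sym (lookup-filter? x)) ([]=⇒lookup x∈)
  ... | yes Px | _ = Px
  ... | no _   | ()

module _ {n m} {f : Fin n → Fin m} {s : Subset n} where

  ∈-image⁺ : ∀ {x y} → x ∈ s → f x ≡ y → y ∈ image f s
  ∈-image⁺ x∈s refl =
    ∈-filter⁺ (λ y → any? (λ x → (x ∈? s) ×-dec (f x ≟ y))) (_ , x∈s , refl)

  ∈-image⁻ : ∀ {y} → y ∈ image f s → ∃[ x ] (x ∈ s × f x ≡ y)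
  ∈-image⁻ = ∈-filter⁻ (λ y → any? (λ x → (x ∈? s) ×-dec (f x ≟ y)))

image-nonempty : ∀ {n m} (f : Fin n → Fin m) {s : Subset n} → Nonempty s → Nonempty (image f s)
image-nonempty f (x , x∈s) = f x , ∈-image⁺ x∈s refl

image-mono : ∀ {n m} (f : Fin n → Fin m) {s t : Subset n} → s ⊆ t → image f s ⊆ image f t
image-mono f s⊆t y∈ with ∈-image⁻ y∈
... | x , x∈s , refl = ∈-image⁺ (s⊆t x∈s) refl

image-∘-invariant : ∀ {n m} (p : Fin n → Fin m) (g : Fin n → Fin n) (s : Subset n)
                  → (∀ x → p (g x) ≡ p x) → image p (image g s) ≡ image p s
image-∘-invariant p g s inv = ⊆-antisym to from
  where
  to : image p (image g s) ⊆ image p s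
  to y∈ with ∈-image⁻ y∈
  ... | z , z∈ , refl with ∈-image⁻ z∈
  ...   | x , x∈s , refl = ∈-image⁺ x∈s (sym (inv x))
  from : image p s ⊆ image p (image g s)
  from y∈ with ∈-image⁻ y∈
  ... | x , x∈s , refl = ∈-image⁺ (∈-image⁺ x∈s refl) (inv x)

module _ {n m} (f : Fin (suc n) → Fin m) (s : Subset n) where

  image-outside∷ : image f (outside ∷ s) ≡ image (f ∘ suc) s
  image-outside∷ = ⊆-antisym to from
    where
    to : image f (outside ∷ s) ⊆ image (f ∘ suc) s
    to y∈ with ∈-image⁻ y∈
    ... | suc x , there x∈s , fx≡y = ∈-image⁺ x∈s fx≡y
    from : image (f ∘ suc) s ⊆ image f (outside ∷ s)
    from y∈ with ∈-image⁻ y∈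
    ... | x , x∈s , fx≡y = ∈-image⁺ (there x∈s) fx≡y

  image-inside∷ : image f (inside ∷ s) ≡ image (f ∘ suc) s ∪ ⁅ f zero ⁆
  image-inside∷ = ⊆-antisym to from
    where
    to : image f (inside ∷ s) ⊆ image (f ∘ suc) s ∪ ⁅ f zero ⁆
    to y∈ with ∈-image⁻ y∈
    ... | zero  , _         , refl  = x∈p∪q⁺ (inj₂ (x∈⁅x⁆ _))
    ... | suc x , there x∈s , fx≡y = x∈p∪q⁺ (inj₁ (∈-image⁺ x∈s fx≡y))
    from : image (f ∘ suc) s ∪ ⁅ f zero ⁆ ⊆ image f (inside ∷ s)
    from y∈ with x∈p∪q⁻ _ _ y∈
    ... | inj₂ y∈⁅f0⁆ = ∈-image⁺ here (sym (x∈⁅y⁆⇒x≡y _ y∈⁅f0⁆))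
    ... | inj₁ y∈′ with ∈-image⁻ y∈′
    ...   | x , x∈s , fx≡y = ∈-image⁺ (there x∈s) fx≡y

image-[] : ∀ {m} (f : Fin 0 → Fin m) → image f [] ≡ ⊥
image-[] f = ⊆-antisym (λ y∈ → no-preimage (∈-image⁻ y∈)) (λ y∈ → ⊥-elim (∉⊥ y∈))
  where
  no-preimage : ∀ {y} → ∃[ x ] (x ∈ [] × f x ≡ y) → y ∈ ⊥
  no-preimage (() , _)

∣p∪⁅x⁆∣≡1+∣p∣ : ∀ {n} (p : Subset n) {x} → x ∉ p → ∣ p ∪ ⁅ x ⁆ ∣ ≡ suc ∣ p ∣
∣p∪⁅x⁆∣≡1+∣p∣ (inside  ∷ p) {zero}  x∉p = ⊥-elim (x∉p here)
∣p∪⁅x⁆∣≡1+∣p∣ (outside ∷ p) {zero}  x∉p = cong (suc ∘ ∣_∣) (∪-identityʳ p)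
∣p∪⁅x⁆∣≡1+∣p∣ (inside  ∷ p) {suc x} x∉p = cong suc (∣p∪⁅x⁆∣≡1+∣p∣ p (x∉p ∘ there))
∣p∪⁅x⁆∣≡1+∣p∣ (outside ∷ p) {suc x} x∉p = ∣p∪⁅x⁆∣≡1+∣p∣ p (x∉p ∘ there)

InjectiveOn : ∀ {n m} → (Fin n → Fin m) → Subset n → Set
InjectiveOn f s = ∀ {x y} → x ∈ s → y ∈ s → f x ≡ f y → x ≡ y

injectiveOn-∷ : ∀ {n m} (f : Fin (suc n) → Fin m) {b s}
              → InjectiveOn f (b ∷ s) → InjectiveOn (f ∘ suc) s
injectiveOn-∷ f inj x∈ y∈ eq = suc-injective (inj (there x∈) (there y∈) eq)

∣image∣≡∣p∣ : ∀ {n m} (f : Fin n → Fin m) (s : Subset n)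
            → InjectiveOn f s → ∣ image f s ∣ ≡ ∣ s ∣
∣image∣≡∣p∣ {m = m} f [] _ = trans (cong ∣_∣ (image-[] f)) (∣⊥∣≡0 m)
∣image∣≡∣p∣ f (outside ∷ s) inj =
  trans (cong ∣_∣ (image-outside∷ f s)) (∣image∣≡∣p∣ (f ∘ suc) s (injectiveOn-∷ f inj))
∣image∣≡∣p∣ f (inside ∷ s) inj = begin
  ∣ image f (inside ∷ s) ∣               ≡⟨ cong ∣_∣ (image-inside∷ f s) ⟩
  ∣ image (f ∘ suc) s ∪ ⁅ f zero ⁆ ∣    ≡⟨ ∣p∪⁅x⁆∣≡1+∣p∣ _ f0∉ ⟩
  suc ∣ image (f ∘ suc) s ∣              ≡⟨ cong suc ih ⟩
  suc ∣ s ∣                              ∎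
  where
  open ≡-Reasoning
  ih : ∣ image (f ∘ suc) s ∣ ≡ ∣ s ∣
  ih = ∣image∣≡∣p∣ (f ∘ suc) s (injectiveOn-∷ f inj)
  f0∉ : f zero ∉ image (f ∘ suc) s
  f0∉ f0∈ with ∈-image⁻ f0∈
  ... | x , x∈s , fx≡f0 with inj (there x∈s) here fx≡f0
  ... | ()

Adj-sym : ∀ {n} (H : Graph n) {x y} → Adj H x y → Adj H y x
Adj-sym H {x} {y} xy = trans (Graph.adj-sym H y x) xy

Adj? : ∀ {n} (H : Graph n) x y → Dec (Adj H x y)
Adj? H x y = Graph.adj H x y Bool.≟ true

module _ {n} {H : Graph n} where

  open DecMembership (_≟_ {n}) using () renaming (_∈?_ to _∈ₗ?_)

  _++ʷ_ : ∀ {l j a b c} → Walk H l a b → Walk H j b c → Walk H (l + j) a c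
  []      ++ʷ V = V
  (e ∷ W) ++ʷ V = e ∷ (W ++ʷ V)

  _∷ʳ_ : ∀ {l a b c} → Walk H l a b → Adj H b c → Walk H (suc l) a c
  []       ∷ʳ e = e ∷ []
  (e′ ∷ W) ∷ʳ e = e′ ∷ (W ∷ʳ e)

  end∈vertices : ∀ {l a b} (W : Walk H l a b) → b ∈ₗ vertices W
  end∈vertices []      = here refl
  end∈vertices (e ∷ W) = there (end∈vertices W)

  ¬simple-closed-walk : ∀ {l a} (W : Walk H (suc l) a a) → ¬ Unique (vertices W)
  ¬simple-closed-walk (e ∷ W) (a∉W ∷ _) = All.lookup a∉W (end∈vertices W) refl

  simple-prefix : ∀ {l a b c} (P : Walk H l a b) → Unique (vertices P) → c ∈ₗ vertices P
                → ∃[ j ] Σ (Walk H j a c) λ W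
                    → Unique (vertices W) × (∀ {v} → v ∈ₗ vertices W → v ∈ₗ vertices P)
  simple-prefix []      _ (here refl) = 0 , [] , [] ∷ [] , λ { (here refl) → here refl }
  simple-prefix (e ∷ P) _ (here refl) = 0 , [] , [] ∷ [] , λ { (here refl) → here refl }
  simple-prefix (e ∷ P) (a∉P ∷ u) (there c∈P) with simple-prefix P u c∈P
  ... | j , W , uW , W⊆P =
    suc j , e ∷ W , All.tabulate (All.lookup a∉P ∘ W⊆P) ∷ uW ,
    λ { (here refl) → here refl ; (there v∈W) → there (W⊆P v∈W) }

  simple-suffix : ∀ {l a b c} (P : Walk H l a b) → Unique (vertices P) → c ∈ₗ vertices P
                → ∃[ j ] SimplePath H j c b
  simple-suffix []      u (here refl)       = _ , [] , u
  simple-suffix (e ∷ P) u (here refl)       = _ , e ∷ P , u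
  simple-suffix (e ∷ P) (_ ∷ u) (there c∈P) = simple-suffix P u c∈P

  walk⇒simplePath : ∀ {l a b} → Walk H l a b → ∃[ j ] SimplePath H j a b
  walk⇒simplePath [] = 0 , [] , [] ∷ []
  walk⇒simplePath (_∷_ {u = a} e W) with walk⇒simplePath W
  ... | j , P , u with a ∈ₗ? vertices P
  ...   | yes a∈P = simple-suffix P u a∈P
  ...   | no  a∉P = suc j , e ∷ P , ¬Any⇒All¬ _ a∉P ∷ u

  data StartsWithEdgeTo : ∀ {j a b} → Walk H j a b → Fin n → Set where
    first-edge : ∀ {j a a′ b} (e : Adj H a a′) (P : Walk H j a′ b)
               → StartsWithEdgeTo (e ∷ P) a′

  -- If a′ lay further along P, the segment of P up to a′ and the edge a′ a
  -- would form a cycle.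
  acyclic-neighbour-on-path : Acyclic H → ∀ {j a a′ b} → Adj H a a′
    → (P : Walk H j a b) → Unique (vertices P) → a′ ∈ₗ vertices P → StartsWithEdgeTo P a′
  acyclic-neighbour-on-path (no-loop , _) e []      _ (here refl) = ⊥-elim (no-loop _ e)
  acyclic-neighbour-on-path (no-loop , _) e (_ ∷ _) _ (here refl) = ⊥-elim (no-loop _ e)
  acyclic-neighbour-on-path (_ , no-cycle) {a′ = a′} e (_∷_ {v = a₁} e₁ P) (a∉P ∷ u)
                            (there a′∈P) with a′ ≟ a₁
  ... | yes refl = first-edge e₁ P
  ... | no a′≢a₁ with simple-prefix P u a′∈P
  ...   | 0     , [] , _  , _   = ⊥-elim (a′≢a₁ refl)
  ...   | suc j , W  , uW , W⊆P =
    ⊥-elim (no-cycle (suc (suc j)) _ _ (s≤s (s≤s z≤n))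
             (e₁ ∷ W , All.tabulate (All.lookup a∉P ∘ W⊆P) ∷ uW) (Adj-sym H e))

connected-neighbour : ∀ {n} {H : Graph n} → Connected H → HasEdge H → ∀ t → ∃ (Adj H t)
connected-neighbour connected (a , b , ab) t with connected t a
... | _ , []                  = b , ab
... | _ , (_∷_ {v = s} ts _) = s , ts

-- Actions in which no walk of length 4 joins two points of an orbit

module OrbitWalks {c ℓ} {Γ : Group c ℓ} {n m} {G : Graph n} {A : Action Γ G}
         {Q : Graph m} {p : Fin n → Fin m} (quotient : IsQuotientGraph A Q p)
         (4-walks-trivial : ∀ v γ → Walk G 4 v (Action.act A γ v)
                                  → Group._≈_ Γ γ (Group.ε Γ))
         where

  open Group Γ using (Carrier; _≈_; ε)
  open Action A
  open IsQuotientGraph quotient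

  G-sym : ∀ {x y} → Adj G x y → Adj G y x
  G-sym = Adj-sym G

  act-≈ε : ∀ {γ} x → γ ≈ ε → act γ x ≡ x
  act-≈ε x γ≈ε = trans (act-cong γ≈ε x) (act-ε x)

  lift-edge : ∀ {x q q′} → p x ≡ q → Adj Q q q′ → ∃[ w ] (Adj G x w × p w ≡ q′)
  lift-edge {x} refl qq′ with adj-to _ _ qq′
  ... | x₀ , y₀ , px₀≡px , py₀≡q′ , x₀y₀ with p-orbit x₀ x px₀≡px
  ...   | γ , refl = act γ y₀ , act-adj γ x₀y₀ , trans (p-inv γ y₀) py₀≡q′

  closed-4-walk : ∀ {y w} → Walk G 4 y w → p w ≡ p y → w ≡ y
  closed-4-walk {y} W pw≡py with p-orbit y _ (sym pw≡py)
  ... | γ , refl = act-≈ε y (4-walks-trivial y γ W)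

  common-neighbour⇒≈ε : ∀ {γ x y} → Adj G x y → Adj G (act γ x) y → γ ≈ ε
  common-neighbour⇒≈ε {γ} xy γxy =
    4-walks-trivial _ γ (xy ∷ G-sym γxy ∷ γxy ∷ G-sym γxy ∷ [])

  common-neighbour⇒≡ : ∀ {x x′ y} → Adj G x y → Adj G x′ y → p x ≡ p x′ → x ≡ x′
  common-neighbour⇒≡ xy x′y px≡px′ =
    sym (closed-4-walk (xy ∷ G-sym x′y ∷ x′y ∷ G-sym x′y ∷ []) (sym px≡px′))

  module Homs {k} {T : Graph k} (T-connected : Connected T) {a b : Fin k} (ab : Adj T a b) where

    T-sym : ∀ {t t′} → Adj T t t′ → Adj T t′ t
    T-sym = Adj-sym T

    next : Fin k → Fin k
    next t = proj₁ (connected-neighbour T-connected (a , b , ab) t)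

    next-adj : ∀ t → Adj T t (next t)
    next-adj t = proj₂ (connected-neighbour T-connected (a , b , ab) t)

    hom-nonempty : ∀ (α : Hom T G) t → Nonempty (proj₁ α t)
    hom-nonempty α = proj₁ (proj₂ α)

    hom-adj : ∀ (α : Hom T G) {t t′ x y}
            → Adj T t t′ → x ∈ proj₁ α t → y ∈ proj₁ α t′ → Adj G x y
    hom-adj α tt′ x∈ y∈ = proj₂ (proj₂ α) _ _ tt′ _ _ x∈ y∈

    p-injectiveOn : ∀ (α : Hom T G) t → InjectiveOn p (proj₁ α t)
    p-injectiveOn α t x∈ x′∈ px≡px′ with hom-nonempty α (next t)
    ... | y , y∈ =
      common-neighbour⇒≡ (hom-adj α (next-adj t) x∈ y∈) (hom-adj α (next-adj t) x′∈ y∈) px≡px′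

    stronglyRegular : StronglyRegularOnHom {T = T} A
    stronglyRegular γ u v w u≤w v≤w γu≐v with hom-nonempty u a | hom-nonempty u b
    ... | x , x∈ua | y , y∈ub =
      common-neighbour⇒≈ε (hom-adj w ab (u≤w a x∈ua) (u≤w b y∈ub))
                          (hom-adj w ab (v≤w a γx∈va) (u≤w b y∈ub))
      where
      γx∈va : act γ x ∈ proj₁ v a
      γx∈va = subst (act γ x ∈_) (γu≐v a) (∈-image⁺ x∈ua refl)

    free : FreeOnHom {T = T} A
    free γ α = stronglyRegular γ α α α (λ _ x∈ → x∈) (λ _ x∈ → x∈)

    mapHom-isHom : ∀ (α : Hom T G) → IsHom T Q (mapHom p (proj₁ α))
    mapHom-isHom α = (λ t → image-nonempty p (hom-nonempty α t)) , adjacent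
      where
      adjacent : ∀ t t′ → Adj T t t′ → ∀ q q′
               → q ∈ mapHom p (proj₁ α) t → q′ ∈ mapHom p (proj₁ α) t′ → Adj Q q q′
      adjacent t t′ tt′ q q′ q∈ q′∈ with ∈-image⁻ q∈ | ∈-image⁻ q′∈
      ... | x , x∈ , refl | y , y∈ , refl = adj-fro x y (hom-adj α tt′ x∈ y∈)

    rank-mapHom : ∀ (α : Hom T G) → rank (mapHom p (proj₁ α)) ≡ rank (proj₁ α)
    rank-mapHom α = cong sum (tabulate-cong λ t →
      cong (_∸ 1) (∣image∣≡∣p∣ p (proj₁ α t) (p-injectiveOn α t)))

    rankPreserving : RankPreservingPosetMap {T = T} A Q p
    rankPreserving = mapHom-isHom , (λ α β α≤β t → image-mono p (α≤β t)) , rank-mapHom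

    mapHom-sameOrbit : ∀ α β → SameOrbit {T = T} A α β
                     → mapHom p (proj₁ α) ≐ mapHom p (proj₁ β)
    mapHom-sameOrbit α β (γ , γα≐β) t =
      trans (sym (image-∘-invariant p (act γ) (proj₁ α t) (p-inv γ)))
            (cong (image p) (γα≐β t))

    orbitLe⇒mapHom-≤ : ∀ α β → OrbitLe {T = T} A α β
                     → mapHom p (proj₁ α) ≤ₕ mapHom p (proj₁ β)
    orbitLe⇒mapHom-≤ α β (γ , α≤γβ) t {q} q∈ =
      subst (q ∈_) (image-∘-invariant p (act γ) (proj₁ β t) (p-inv γ))
            (image-mono p (α≤γβ t) q∈)

    Covered : Hom T G → Hom T G → Carrier → Fin k → Set
    Covered α β γ t = proj₁ α t ⊆ image (act γ) (proj₁ β t)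

    module _ (α β : Hom T G) (pα≤pβ : mapHom p (proj₁ α) ≤ₕ mapHom p (proj₁ β)) where

      covered-next-to-point : ∀ {γ t t′ y} → Adj T t t′
        → y ∈ proj₁ β t → act γ y ∈ proj₁ α t → Covered α β γ t′
      covered-next-to-point {γ} {y = y} tt′ y∈β γy∈α {x} x∈α
        with ∈-image⁻ (pα≤pβ _ (∈-image⁺ x∈α refl))
      ... | y′ , y′∈β , py′≡px = ∈-image⁺ y′∈β (sym x≡γy′)
        where
        x≡γy′ : x ≡ act γ y′
        x≡γy′ = common-neighbour⇒≡ (hom-adj α (T-sym tt′) x∈α γy∈α)
                                   (act-adj γ (hom-adj β (T-sym tt′) y′∈β y∈β))
                                   (sym (trans (p-inv γ y′) py′≡px))

      covered-step : ∀ {γ t t′} → Adj T t t′ → Covered α β γ t → Covered α β γ t′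
      covered-step {t = t} tt′ cov with hom-nonempty α t
      ... | x , x∈α with ∈-image⁻ (cov x∈α)
      ...   | y , y∈β , refl = covered-next-to-point tt′ y∈β x∈α

      covered-along : ∀ {γ l t t′} → Walk T l t t′ → Covered α β γ t → Covered α β γ t′
      covered-along []         cov = cov
      covered-along (tt′ ∷ W) cov = covered-along W (covered-step tt′ cov)

      mapHom-≤⇒orbitLe : OrbitLe {T = T} A α β
      mapHom-≤⇒orbitLe with hom-nonempty α a
      ... | x , x∈α with ∈-image⁻ (pα≤pβ a (∈-image⁺ x∈α refl))
      ...   | y , y∈β , py≡px with p-orbit y x py≡px
      ...     | γ , refl = γ , λ t →
        covered-along (proj₂ (T-connected a t))
                      (covered-step (T-sym ab) (covered-next-to-point ab y∈β x∈α))

    mapHom-≐⇒sameOrbit : ∀ α β → mapHom p (proj₁ α) ≐ mapHom p (proj₁ β)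
                       → SameOrbit {T = T} A α β
    mapHom-≐⇒sameOrbit α β pα≐pβ
      with mapHom-≤⇒orbitLe β α (λ t → subst (_ ⊆_) (sym (pα≐pβ t)) (λ q∈ → q∈))
    ... | γ , β≤γα = γ , λ t → ⊆-antisym (γα⊆β t) (β≤γα t)
      where
      γα⊆β : ∀ t → image (act γ) (proj₁ α t) ⊆ proj₁ β t
      γα⊆β t z∈ with ∈-image⁻ z∈
      ... | x , x∈α , refl
        with ∈-image⁻ (subst (p (act γ x) ∈_) (pα≐pβ t) (∈-image⁺ x∈α (sym (p-inv γ x))))
      ...   | y , y∈β , py≡pγx with ∈-image⁻ (β≤γα t y∈β)
      ...     | x′ , x′∈α , refl =
        subst (_∈ proj₁ β t)
              (cong (act γ) (p-injectiveOn α t x′∈α x∈α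
                              (trans (sym (p-inv γ x′)) (trans py≡pγx (p-inv γ x)))))
              y∈β

    -- Lifting along a spanning tree

    module Lifting (S : Graph k) (S-spanning : IsSpanningTree T S)
             (cycles-trivial : ∀ v γ l → CycleLength T S l → Walk G l v (act γ v) → γ ≈ ε)
             where

      open DecMembership (_≟_ {k}) using () renaming (_∈?_ to _∈ₗ?_)

      S⊆T : ∀ {t t′} → Adj S t t′ → Adj T t t′
      S⊆T = proj₁ S-spanning _ _

      S-connected : Connected S
      S-connected = proj₁ (proj₂ S-spanning)

      S-acyclic : Acyclic S
      S-acyclic = proj₂ (proj₂ S-spanning)

      module _ (o : Fin k → Fin m) (o-adj : ∀ {t t′} → Adj T t t′ → Adj Q (o t) (o t′))
               where

        data Lift : ∀ {l t t′} → Walk S l t t′ → Fin n → Fin n → Set where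
          stop : ∀ {t x} → p x ≡ o t → Lift ([] {v = t}) x x
          step : ∀ {l t t′ t″} {e : Adj S t t′} {W : Walk S l t′ t″} {x y z}
               → p x ≡ o t → Adj G x y → Lift W y z → Lift (e ∷ W) x z

        lift-start : ∀ {l t t′} {W : Walk S l t t′} {x z} → Lift W x z → p x ≡ o t
        lift-start (stop px)     = px
        lift-start (step px _ _) = px

        lift-walk : ∀ {l t t′} {W : Walk S l t t′} {x z} → Lift W x z → Walk G l x z
        lift-walk (stop _)      = []
        lift-walk (step _ xy L) = xy ∷ lift-walk L

        _++ᴸ_ : ∀ {l j t t′ t″} {W : Walk S l t t′} {V : Walk S j t′ t″} {x y z}
              → Lift W x y → Lift V y z → Lift (W ++ʷ V) x z
        stop _       ++ᴸ L′ = L′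
        step px xy L ++ᴸ L′ = step px xy (L ++ᴸ L′)

        lift-backwards : ∀ {l t t′} (W : Walk S l t t′) z → p z ≡ o t′ → ∃[ x ] Lift W x z
        lift-backwards []      z pz = z , stop pz
        lift-backwards (e ∷ W) z pz with lift-backwards W z pz
        ... | y , L with lift-edge (lift-start L) (o-adj (T-sym (S⊆T e)))
        ...   | x , yx , px = x , step px (G-sym yx) L

        -- Induction on W: a step of W leaving the simple path P is undone by
        -- prolonging P, and a step along P follows P; any other step would
        -- close a cycle in S.
        lift-start-unique : ∀ {l j t t′} (W : Walk S l t t′) (P : Walk S j t t′)
          → Unique (vertices P) → ∀ {x x′ z} → Lift W x z → Lift P x′ z → x ≡ x′
        lift-start-unique [] [] _ (stop _) (stop _) = refl
        lift-start-unique [] (e ∷ P) P-simple _ _ = ⊥-elim (¬simple-closed-walk (e ∷ P) P-simple)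
        lift-start-unique (_∷_ {v = t₁} e W) P P-simple (step px xy L) LP
          with t₁ ∈ₗ? vertices P
        ... | no t₁∉P with lift-edge (lift-start LP) (o-adj (S⊆T e))
        ...   | y′ , x′y′ , py′
          with lift-start-unique W (Adj-sym S e ∷ P) (¬Any⇒All¬ _ t₁∉P ∷ P-simple) L
                                 (step py′ (G-sym x′y′) LP)
        ...     | refl = common-neighbour⇒≡ xy x′y′ (trans px (sym (lift-start LP)))
        lift-start-unique (e ∷ W) P P-simple (step px xy L) LP | yes t₁∈P
          with acyclic-neighbour-on-path S-acyclic e P P-simple t₁∈P
        lift-start-unique (e ∷ W) _ (_ ∷ P′-simple) (step px xy L) (step px′ x′y′ LP′)
          | yes _ | first-edge _ P′ with lift-start-unique W P′ P′-simple L LP′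
        ... | refl = common-neighbour⇒≡ xy x′y′ (trans px (sym px′))

        route : ∀ t → ∃[ j ] SimplePath S j t a
        route t = walk⇒simplePath (proj₂ (S-connected t a))

        lift-route : ∀ t → ∃[ x ] Lift (proj₁ (proj₂ (route t))) x (proj₁ (p-surj (o a)))
        lift-route t = lift-backwards (proj₁ (proj₂ (route t))) _ (proj₂ (p-surj (o a)))

        vertex-lift : Fin k → Fin n
        vertex-lift t = proj₁ (lift-route t)

        vertex-lift-over : ∀ t → p (vertex-lift t) ≡ o t
        vertex-lift-over t = lift-start (proj₂ (lift-route t))

        lift-ending-at-vertex-lift : ∀ {l t t′} (W : Walk S l t t′) {x}
          → Lift W x (vertex-lift t′) → x ≡ vertex-lift t
        lift-ending-at-vertex-lift {t = t} {t′} W L =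
          lift-start-unique (W ++ʷ proj₁ (proj₂ (route t′))) (proj₁ (proj₂ (route t)))
                            (proj₂ (proj₂ (route t)))
                            (L ++ᴸ proj₂ (lift-route t′)) (proj₂ (lift-route t))

        vertex-lift-adj-tree : ∀ {t t′} → Adj S t t′ → Adj G (vertex-lift t) (vertex-lift t′)
        vertex-lift-adj-tree {t} {t′} tt′
          with lift-edge (vertex-lift-over t′) (o-adj (T-sym (S⊆T tt′)))
        ... | x , t′x , px
          with lift-ending-at-vertex-lift (tt′ ∷ [])
                 (step px (G-sym t′x) (stop (vertex-lift-over t′)))
        ...   | refl = G-sym t′x

        -- The lift of the fundamental cycle of the chord t t′ runs from the lift
        -- of t into its orbit.
        vertex-lift-adj-chord : ∀ {t t′} → Adj T t t′ → ¬ Adj S t t′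
          → Adj G (vertex-lift t) (vertex-lift t′)
        vertex-lift-adj-chord {t} {t′} tt′ tt′∉S
          with walk⇒simplePath (proj₂ (S-connected t t′))
        ... | j , R , R-simple with lift-backwards R (vertex-lift t′) (vertex-lift-over t′)
        ...   | x , L with lift-ending-at-vertex-lift R L
        ...     | refl with lift-edge (vertex-lift-over t′) (o-adj (T-sym tt′))
        ...       | y , t′y , py with p-orbit (vertex-lift t) y (trans (vertex-lift-over t) (sym py))
        ...         | γ , refl =
          G-sym (subst (Adj G (vertex-lift t′)) (act-≈ε (vertex-lift t) γ≈ε) t′y)
          where
          γ≈ε : γ ≈ ε
          γ≈ε = cycles-trivial (vertex-lift t) γ (suc j)
                  (t , t′ , tt′ , tt′∉S , j , refl , R , R-simple) (lift-walk L ∷ʳ t′y)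

        vertex-lift-adj : ∀ {t t′} → Adj T t t′ → Adj G (vertex-lift t) (vertex-lift t′)
        vertex-lift-adj {t} {t′} tt′ with Adj? S t t′
        ... | yes tt′∈S = vertex-lift-adj-tree tt′∈S
        ... | no  tt′∉S = vertex-lift-adj-chord tt′ tt′∉S

      module HomLift (β : Hom T Q) where

        o : Fin k → Fin m
        o t = proj₁ (proj₁ (proj₂ β) t)

        o∈β : ∀ t → o t ∈ proj₁ β t
        o∈β t = proj₂ (proj₁ (proj₂ β) t)

        β-adj : ∀ {t t′ q q′}
              → Adj T t t′ → q ∈ proj₁ β t → q′ ∈ proj₁ β t′ → Adj Q q q′
        β-adj tt′ q∈ q′∈ = proj₂ (proj₂ β) _ _ tt′ _ _ q∈ q′∈

        f : Fin k → Fin n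
        f = vertex-lift o (λ tt′ → β-adj tt′ (o∈β _) (o∈β _))

        f-over : ∀ t → p (f t) ≡ o t
        f-over = vertex-lift-over o (λ tt′ → β-adj tt′ (o∈β _) (o∈β _))

        f-adj : ∀ {t t′} → Adj T t t′ → Adj G (f t) (f t′)
        f-adj = vertex-lift-adj o (λ tt′ → β-adj tt′ (o∈β _) (o∈β _))

        member? : ∀ t → Decidable (λ x → p x ∈ proj₁ β t × Adj G x (f (next t)))
        member? t x = (p x ∈? proj₁ β t) ×-dec Adj? G x (f (next t))

        α : RawHom k n
        α t = filter? (member? t)

        α-adj-f : ∀ {t s x} → x ∈ α t → Adj T t s → Adj G x (f s)
        α-adj-f {t} {s} x∈α ts with ∈-filter⁻ (member? t) x∈α
        ... | px∈β , x-f-next with lift-edge refl (β-adj ts px∈β (o∈β s))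
        ...   | w , xw , pw≡os =
          subst (Adj G _)
                (closed-4-walk
                  (f-adj (T-sym ts) ∷ f-adj (next-adj t) ∷ G-sym x-f-next ∷ xw ∷ [])
                  (trans pw≡os (sym (f-over s))))
                xw

        α-isHom : IsHom T G α
        α-isHom = f∈α , α-adj
          where
          f∈α : ∀ t → Nonempty (α t)
          f∈α t = f t , ∈-filter⁺ (member? t)
                          (subst (_∈ proj₁ β t) (sym (f-over t)) (o∈β t) , f-adj (next-adj t))
          α-adj : ∀ t t′ → Adj T t t′ → ∀ x y → x ∈ α t → y ∈ α t′ → Adj G x y
          α-adj t t′ tt′ x y x∈α y∈α
            with lift-edge refl (β-adj tt′ (proj₁ (∈-filter⁻ (member? t) x∈α))
                                           (proj₁ (∈-filter⁻ (member? t′) y∈α)))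
          ... | w , xw , pw≡py =
            subst (Adj G x)
                  (closed-4-walk
                    (α-adj-f y∈α (T-sym tt′) ∷ f-adj tt′ ∷ G-sym (α-adj-f x∈α tt′) ∷ xw ∷ [])
                    pw≡py)
                  xw

        mapHom-α : mapHom p α ≐ proj₁ β
        mapHom-α t = ⊆-antisym to from
          where
          to : image p (α t) ⊆ proj₁ β t
          to q∈ with ∈-image⁻ q∈
          ... | x , x∈α , refl = proj₁ (∈-filter⁻ (member? t) x∈α)
          from : proj₁ β t ⊆ image p (α t)
          from q∈
            with lift-edge (f-over (next t)) (β-adj (T-sym (next-adj t)) (o∈β (next t)) q∈)
          ... | w , f-next-w , refl =
            ∈-image⁺ (∈-filter⁺ (member? t) (q∈ , G-sym f-next-w)) refl

      surjective : ∀ (β : Hom T Q) → Σ (Hom T G) λ α → mapHom p (proj₁ α) ≐ proj₁ β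
      surjective β = (HomLift.α β , HomLift.α-isHom β) , HomLift.mapHom-α β

proposition5p8 : ∀ {c ℓ} (Γ : Group c ℓ) {k n m : ℕ}
  (T : Graph k) (G : Graph n) (A : Action Γ G)
  (Q : Graph m) (p : Fin n → Fin m) → IsQuotientGraph A Q p
  → Connected T → HasEdge T
  → (S : Graph k) → IsSpanningTree T S
  → (∀ v γ l → CycleLength T S l ⊎ l ≡ 4
       → Walk G l v (Action.act A γ v) → Group._≈_ Γ γ (Group.ε Γ))
  → StronglyRegularOnHom {T = T} A × FreeOnHom {T = T} A
    × RankPreservingPosetMap {T = T} A Q p
    × InducedPosetIso {T = T} A Q p
proposition5p8 Γ T G A Q p quotient T-connected (_ , _ , ab) S S-spanning walks-trivial =
  stronglyRegular , free , rankPreserving , record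
    { well-defined = mapHom-sameOrbit
    ; injective    = mapHom-≐⇒sameOrbit
    ; surjective   = surjective
    ; monotone     = orbitLe⇒mapHom-≤
    ; reflecting   = mapHom-≤⇒orbitLe
    }
  where
  open OrbitWalks quotient (λ v γ → walks-trivial v γ 4 (inj₂ refl))
  open Homs T-connected ab
  open Lifting S S-spanning (λ v γ l cycle → walks-trivial v γ l (inj₁ cycle))
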